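{- For every integer $d > 2$, the set $C = \{ -d,\dots,-1,1,\dots,d\}$ has a pair of good coefficient set factors.
   Context: For a finite coefficient set $C\subseteq\mathbb{Z}$, integer sets $C_1, C_2$ are a pair of good coefficient set factors of $C$ if $C_1 + C_2 = \{a+b: a\in C_1, b\in C_2\} = C$ and there is a constant $\varepsilon>0$ such that, as $n\to\infty$ (over $n$ for which perfectly balanced vectors exist), $\frac{|C_1|^{n/2}|C_2|^{n/2}}{|P(\vec{c},C_1,C_2)|} = o\left(|C|^{n/2}\cdot 2^{ -\varepsilon n}\right)$, where $\vec{c}\in C^n$ is any perfectly balanced vector (each element of $C$ appears exactly $n/|C|$ times in $\vec{c}$) and $P(\vec{c},C_1,C_2)$ is the set of pairs $(\vec{a},\vec{b})$ with $\vec{a}$ having first $n/2$ coordinates in $C_1$ and last $n/2$ in $C_2$, $\vec{b}$ having first $n/2$ coordinates in $C_2$ and last $n/2$ in $C_1$, and $\vec{a}+\vec{b}=\vec{c}$. -}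

module Defs where

open import Data.Nat as ℕ using (ℕ; zero; suc; _≤_; _<_; _^_; _<ᵇ_)
open import Data.Nat.Divisibility using (_∣_)
import Data.Nat.Properties as ℕP
open import Data.Nat.DivMod using (_/_)
open import Data.Integer as ℤ using (ℤ; +_; -[1+_])
import Data.Integer.Properties as ℤP
open import Data.Fin using (Fin; toℕ)
open import Data.Bool using (if_then_else_)
open import Data.List as List using (List; []; _∷_; length; filter; upTo; concatMap; _++_)
open import Data.List.Relation.Unary.Unique.Propositional using (Unique)
open import Data.List.Membership.Propositional using (_∈_)
open import Data.Vec as Vec using (Vec; toList; zipWith)
import Data.Vec.Properties as VecP
open import Data.Product using (_×_; _,_; ∃-syntax)
open import Function.Bundles using (_⇔_)
open import Relation.Binary.PropositionalEquality using (_≡_)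

Cset : ℕ → List ℤ
Cset d = List.map (λ k → -[1+ k ]) (upTo d) ++ List.map (λ k → + suc k) (upTo d)

SumsetEq : List ℤ → List ℤ → List ℤ → Set
SumsetEq C₁ C₂ C = ∀ z → z ∈ C ⇔ (∃[ a ] ∃[ b ] (a ∈ C₁ × b ∈ C₂ × z ≡ a ℤ.+ b))

occ : ∀ {n} → ℤ → Vec ℤ n → ℕ
occ x v = length (filter (ℤ._≟ x) (toList v))

-- c ∈ Cⁿ is perfectly balanced: entries in C, and every element of C
-- appears exactly n/|C| times (written occ·|C| = n).
PerfectlyBalanced : (C : List ℤ) → (n : ℕ) → Vec ℤ n → Set
PerfectlyBalanced C n c =
  (∀ i → Vec.lookup c i ∈ C) × (∀ x → x ∈ C → occ x c ℕ.* length C ≡ n)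

vecsFrom : (n : ℕ) → (Fin n → List ℤ) → List (Vec ℤ n)
vecsFrom zero L = Vec.[] ∷ []
vecsFrom (suc n) L =
  concatMap (λ x → List.map (x Vec.∷_) (vecsFrom n (λ i → L (Fin.suc i)))) (L Fin.zero)
  where import Data.Fin as Fin

halfSel : (n : ℕ) → List ℤ → List ℤ → Fin n → List ℤ
halfSel n A B i = if toℕ i <ᵇ n / 2 then A else B

Pset : (n : ℕ) → Vec ℤ n → List ℤ → List ℤ → List (Vec ℤ n × Vec ℤ n)
Pset n c C₁ C₂ =
  filter (λ ab → VecP.≡-dec ℤ._≟_ (zipWith ℤ._+_ (Data.Product.proj₁ ab) (Data.Product.proj₂ ab)) c)
    (List.cartesianProduct (vecsFrom n (halfSel n C₁ C₂)) (vecsFrom n (halfSel n C₂ C₁)))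
  where import Data.Product

Pcard : (n : ℕ) → Vec ℤ n → List ℤ → List ℤ → ℕ
Pcard n c C₁ C₂ = length (Pset n c C₁ C₂)

-- Good coefficient set factors.  ε > 0 is taken rational, ε = p/q (no loss:
-- the condition is monotone in ε).  "f(n) = o(g(n))" is rendered as:
-- for every m ≥ 1, eventually f(n) ≤ g(n)/m.  Here
--   f = |C₁|^{n/2}|C₂|^{n/2} / |P|,  g = |C|^{n/2} 2^{-εn},
-- and the inequality  m·|C₁|^{n/2}|C₂|^{n/2}·2^{pn/q} ≤ |C|^{n/2}·|P|
-- is raised to the q-th power to stay in ℕ.  n ranges over n with
-- perfectly balanced vectors, i.e. |C| ∣ n, and the bound is required
-- for every perfectly balanced c ∈ Cⁿ.
GoodFactors : List ℤ → List ℤ → List ℤ → Set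
GoodFactors C C₁ C₂ =
  SumsetEq C₁ C₂ C ×
  ∃[ p ] ∃[ q ] (1 ≤ p × 1 ≤ q ×
    (∀ m → 1 ≤ m → ∃[ N ] ∀ n → N ≤ n → length C ∣ n →
       ∀ (c : Vec ℤ n) → PerfectlyBalanced C n c →
         (m ^ q) ℕ.* ((length C₁ ℕ.* length C₂) ^ ((n / 2) ℕ.* q)) ℕ.* (2 ^ (p ℕ.* n))
           ≤ (length C ^ ((n / 2) ℕ.* q)) ℕ.* (Pcard n c C₁ C₂ ^ q)))

HasGoodFactors : List ℤ → Set
HasGoodFactors C = ∃[ C₁ ] ∃[ C₂ ] (Unique C₁ × Unique C₂ × GoodFactors C C₁ C₂)

-- Take C₁ = {0, 1} and C₂ = {-d, …, -2} ∪ {1, …, d - 1}: then C₁ + C₂ = C, although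
-- |C₁| |C₂| = 4(d - 1) exceeds |C| = 2d.  Every z ∈ C other than ±1 and ±d has the two
-- representations 0 + z and 1 + (z - 1), so if c is perfectly balanced, each value occurring
-- k = n / 2d times, counting coordinatewise gives |P(c, C₁, C₂)| ≥ 2^(n - 4k).  With ε = 1/q,
-- q = 2(2d + 1), the required bound then reduces to 512 (d - 1)^(2d) ≤ (2d)^(2d), which follows
-- from Bernoulli's inequality (1 + 1/(d - 1))^d ≥ 2 when d ≥ 4 and is checked directly for d = 3.
-- The factor m of the o(·) condition is absorbed by taking n ≥ 2d m^q, so that m^q ≤ k ≤ 2^k.

module Submission where

open import Defs
open import Data.Bool using (Bool; true; false; _∧_; if_then_else_)
open import Data.Empty using (⊥-elim)
open import Data.Fin using (Fin; toℕ)
import Data.Fin as Fin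
open import Data.List using (List; []; _∷_; _++_; map; concatMap; cartesianProduct; length; filter; upTo)
import Data.List.Properties as ListP
open import Data.List.Membership.Propositional using (_∈_; _∉_)
open import Data.List.Membership.Propositional.Properties using (∈-++⁺ˡ; ∈-++⁺ʳ; ∈-++⁻; ∈-map⁺; ∈-map⁻; ∈-upTo⁺; ∈-upTo⁻)
open import Data.List.Relation.Unary.Any using (here; there)
open import Data.List.Relation.Unary.AllPairs using ([]; _∷_)
open import Data.List.Relation.Unary.All using ([]; _∷_)
open import Data.List.Relation.Unary.Unique.Propositional using (Unique)
import Data.List.Relation.Unary.Unique.Propositional.Properties as Unique
open import Data.Nat using (ℕ; zero; suc; _+_; _*_; _^_; _≤_; _<_; _<?_; s≤s; z≤n; NonZero; _<ᵇ_)
open import Data.Nat.Properties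
open import Data.Nat.DivMod using (_/_; m*n/n≡m)
open import Data.Nat.Tactic.RingSolver using (solve-∀)
open import Data.Product using (_×_; _,_; proj₁; proj₂; ∃-syntax)
open import Data.Sum using (_⊎_; inj₁; inj₂)
open import Data.Unit using (tt)
open import Data.Vec as Vec using (Vec; toList; zipWith; lookup)
import Data.Vec.Properties as VecP
open import Function.Bundles using (mk⇔; Equivalence)
open import Relation.Nullary using (¬_; Dec; yes; no; does)
open import Relation.Nullary.Decidable using (dec-true)
open import Relation.Unary using (Pred; Decidable)
open import Relation.Binary.PropositionalEquality

private variable
  A B : Set

⟦_⟧ : Bool → ℕ
⟦ true  ⟧ = 1
⟦ false ⟧ = 0

⟦∧⟧ : ∀ a b → ⟦ a ∧ b ⟧ ≡ ⟦ a ⟧ * ⟦ b ⟧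
⟦∧⟧ true  b = sym (*-identityˡ ⟦ b ⟧)
⟦∧⟧ false b = refl

⟦does⟧≡1 : ∀ {P : Set} (P? : Dec P) → P → ⟦ does P? ⟧ ≡ 1
⟦does⟧≡1 P? p = cong ⟦_⟧ (dec-true P? p)

∑ : List A → (A → ℕ) → ℕ
∑ []       f = 0
∑ (x ∷ xs) f = f x + ∑ xs f

∑-++ : ∀ (xs ys : List A) f → ∑ (xs ++ ys) f ≡ ∑ xs f + ∑ ys f
∑-++ []       ys f = refl
∑-++ (x ∷ xs) ys f = trans (cong (f x +_) (∑-++ xs ys f)) (sym (+-assoc (f x) _ _))

∑-map : ∀ (g : A → B) xs f → ∑ (map g xs) f ≡ ∑ xs (λ x → f (g x))
∑-map g []       f = refl
∑-map g (x ∷ xs) f = cong (f (g x) +_) (∑-map g xs f)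

∑-cong : ∀ (xs : List A) {f g} → (∀ x → f x ≡ g x) → ∑ xs f ≡ ∑ xs g
∑-cong []       eq = refl
∑-cong (x ∷ xs) eq = cong₂ _+_ (eq x) (∑-cong xs eq)

∑-concatMap : ∀ (g : A → List B) xs f → ∑ (concatMap g xs) f ≡ ∑ xs (λ x → ∑ (g x) f)
∑-concatMap g []       f = refl
∑-concatMap g (x ∷ xs) f =
  trans (∑-++ (g x) (concatMap g xs) f) (cong (∑ (g x) f +_) (∑-concatMap g xs f))

∑-cartesianProduct : ∀ (xs : List A) (ys : List B) f →
  ∑ (cartesianProduct xs ys) f ≡ ∑ xs (λ x → ∑ ys (λ y → f (x , y)))
∑-cartesianProduct []       ys f = refl
∑-cartesianProduct (x ∷ xs) ys f =
  trans (∑-++ (map (x ,_) ys) _ f) (cong₂ _+_ (∑-map (x ,_) ys f) (∑-cartesianProduct xs ys f))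

∑-*ˡ : ∀ k (xs : List A) f → ∑ xs (λ x → k * f x) ≡ k * ∑ xs f
∑-*ˡ k []       f = sym (*-zeroʳ k)
∑-*ˡ k (x ∷ xs) f = trans (cong (k * f x +_) (∑-*ˡ k xs f)) (sym (*-distribˡ-+ k (f x) _))

∑-*ʳ : ∀ k (xs : List A) f → ∑ xs (λ x → f x * k) ≡ ∑ xs f * k
∑-*ʳ k []       f = refl
∑-*ʳ k (x ∷ xs) f = trans (cong (f x * k +_) (∑-*ʳ k xs f)) (sym (*-distribʳ-+ k (f x) _))

∑-product : ∀ (xs : List A) (ys : List B) f g →
  ∑ xs (λ x → ∑ ys (λ y → f x * g y)) ≡ ∑ xs f * ∑ ys g
∑-product xs ys f g = trans (∑-cong xs (λ x → ∑-*ˡ (f x) ys g)) (∑-*ʳ (∑ ys g) xs f)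

∑-+ : ∀ (xs : List A) f g → ∑ xs (λ x → f x + g x) ≡ ∑ xs f + ∑ xs g
∑-+ []       f g = refl
∑-+ (x ∷ xs) f g = trans (cong (f x + g x +_) (∑-+ xs f g)) (+-+-comm (f x) _ _ _)
  where
  +-+-comm : ∀ a b c d → a + b + (c + d) ≡ a + c + (b + d)
  +-+-comm = solve-∀

∑-swap : ∀ (xs : List A) (ys : List B) (f : A → B → ℕ) →
  ∑ xs (λ x → ∑ ys (λ y → f x y)) ≡ ∑ ys (λ y → ∑ xs (λ x → f x y))
∑-swap []       ys f = sym (∑-zero ys)
  where
  ∑-zero : ∀ (ys : List B) → ∑ ys (λ _ → 0) ≡ 0
  ∑-zero []       = refl
  ∑-zero (y ∷ ys) = ∑-zero ys
∑-swap (x ∷ xs) ys f =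
  trans (cong (∑ ys (f x) +_) (∑-swap xs ys f)) (sym (∑-+ ys (f x) (λ y → ∑ xs (λ x → f x y))))

∈⇒≤∑ : ∀ {xs : List A} {x} f → x ∈ xs → f x ≤ ∑ xs f
∈⇒≤∑ {xs = y ∷ ys} f (here refl) = m≤m+n (f y) _
∈⇒≤∑ {xs = y ∷ ys} f (there x∈) = ≤-trans (∈⇒≤∑ f x∈) (m≤n+m _ (f y))

∑-const-on : ∀ (xs : List A) {f k} → (∀ x → x ∈ xs → f x ≡ k) → ∑ xs f ≡ length xs * k
∑-const-on []       eq = refl
∑-const-on (x ∷ xs) eq = cong₂ _+_ (eq x (here refl)) (∑-const-on xs (λ y y∈ → eq y (there y∈)))

length-filter≡∑ : ∀ {p} {P : Pred A p} (P? : Decidable P) xs → length (filter P? xs) ≡ ∑ xs (λ x → ⟦ does (P? x) ⟧)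
length-filter≡∑ P? []       = refl
length-filter≡∑ P? (x ∷ xs) with does (P? x)
... | true  = cong suc (length-filter≡∑ P? xs)
... | false = length-filter≡∑ P? xs

∑-toList-mono : ∀ {n} (c : Vec A n) {f g} → (∀ i → f (lookup c i) ≤ g (lookup c i)) →
  ∑ (toList c) f ≤ ∑ (toList c) g
∑-toList-mono Vec.[]       h = z≤n
∑-toList-mono (x Vec.∷ c) h = +-mono-≤ (h Fin.zero) (∑-toList-mono c (λ i → h (Fin.suc i)))

^-distribʳ-* : ∀ a b n → (a * b) ^ n ≡ a ^ n * b ^ n
^-distribʳ-* a b zero    = refl
^-distribʳ-* a b (suc n) = trans (cong (a * b *_) (^-distribʳ-* a b n)) (interchange a b _ _)
  where
  interchange : ∀ a b x y → a * b * (x * y) ≡ a * x * (b * y)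
  interchange = solve-∀

^-*-split : ∀ x a N {E} → E ≡ a * N → x ^ E ≡ (x ^ a) ^ N
^-*-split x a N refl = sym (^-*-assoc x a N)

n≤2^n : ∀ n → n ≤ 2 ^ n
n≤2^n zero    = z≤n
n≤2^n (suc n) = ≤-trans (+-mono-≤ (m^n>0 2 n) (n≤2^n n)) (≤-reflexive (double (2 ^ n)))
  where
  double : ∀ x → x + x ≡ 2 * x
  double = solve-∀

bernoulli : ∀ a n → a ^ n * (a + n) ≤ a * suc a ^ n
bernoulli a zero    = ≤-reflexive (base a)
  where
  base : ∀ a → 1 * (a + 0) ≡ a * 1
  base = solve-∀
bernoulli a (suc n) = begin
  a * a ^ n * (a + suc n)          ≡⟨ expand a (a ^ n) n ⟩
  a ^ n * (a * (a + n) + a)        ≤⟨ *-monoʳ-≤ (a ^ n) (+-monoʳ-≤ (a * (a + n)) (m≤m+n a n)) ⟩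
  a ^ n * (a * (a + n) + (a + n))  ≡⟨ factor a (a ^ n) n ⟩
  suc a * (a ^ n * (a + n))        ≤⟨ *-monoʳ-≤ (suc a) (bernoulli a n) ⟩
  suc a * (a * suc a ^ n)          ≡⟨ *-left-comm (suc a) a _ ⟩
  a * suc a ^ suc n                ∎
  where
  open ≤-Reasoning
  expand : ∀ a x n → a * x * (a + suc n) ≡ x * (a * (a + n) + a)
  expand = solve-∀
  factor : ∀ a x n → x * (a * (a + n) + (a + n)) ≡ suc a * (x * (a + n))
  factor = solve-∀
  *-left-comm : ∀ a b c → a * (b * c) ≡ b * (a * c)
  *-left-comm = solve-∀

2*n^[1+n]≤[1+n]^[1+n] : ∀ n .{{_ : NonZero n}} → 2 * n ^ suc n ≤ suc n ^ suc n
2*n^[1+n]≤[1+n]^[1+n] n = *-cancelˡ-≤ n (begin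
  n * (2 * n ^ suc n)    ≡⟨ rearrange n (n ^ suc n) ⟩
  n ^ suc n * (n + n)    ≤⟨ *-monoʳ-≤ (n ^ suc n) (+-monoʳ-≤ n (n≤1+n n)) ⟩
  n ^ suc n * (n + suc n) ≤⟨ bernoulli n (suc n) ⟩
  n * suc n ^ suc n      ∎)
  where
  open ≤-Reasoning
  rearrange : ∀ n x → n * (2 * x) ≡ x * (n + n)
  rearrange = solve-∀

512*e^L≤L^L : ∀ e → 2 ≤ e → let L = suc e + suc e in 512 * e ^ L ≤ L ^ L
512*e^L≤L^L 1 (s≤s ())
512*e^L≤L^L 2 _                     = ≤ᵇ⇒≤ (512 * 2 ^ 6) (6 ^ 6) tt
512*e^L≤L^L e@(suc (suc (suc _))) _ = begin
  512 * e ^ (D + D)                  ≡⟨ cong (512 *_) (^-distribˡ-+-* e D D) ⟩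
  512 * (e ^ D * e ^ D)              ≡⟨ square-twice (e ^ D) ⟩
  128 * ((2 * e ^ D) * (2 * e ^ D))  ≤⟨ *-monoʳ-≤ 128 (*-mono-≤ (2*n^[1+n]≤[1+n]^[1+n] e) (2*n^[1+n]≤[1+n]^[1+n] e)) ⟩
  128 * (D ^ D * D ^ D)              ≡⟨ cong (128 *_) (sym (^-distribˡ-+-* D D D)) ⟩
  128 * D ^ (D + D)                  ≤⟨ *-monoˡ-≤ (D ^ (D + D)) (^-monoʳ-≤ 2 7≤D+D) ⟩
  2 ^ (D + D) * D ^ (D + D)          ≡⟨ sym (^-distribʳ-* 2 D (D + D)) ⟩
  (2 * D) ^ (D + D)                  ≡⟨ cong (_^ (D + D)) (double D) ⟩
  (D + D) ^ (D + D)                  ∎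
  where
  open ≤-Reasoning
  D = suc e
  7≤D+D : 7 ≤ D + D
  7≤D+D = +-mono-≤ {3} {D} (s≤s (s≤s (s≤s z≤n))) (s≤s (s≤s (s≤s (s≤s z≤n))))
  square-twice : ∀ x → 512 * (x * x) ≡ 128 * ((2 * x) * (2 * x))
  square-twice = solve-∀
  double : ∀ x → 2 * x ≡ x + x
  double = solve-∀

-- For d = D = e + 1: S = |C₁| |C₂|, L = |C|, and ε = 1/q.
module Exponents (e : ℕ) (2≤e : 2 ≤ e) where

  D L S r q : ℕ
  D = suc e
  L = D + D
  S = 4 * e
  r = suc L
  q = 2 * r

  512*S^L≤4^L*L^L : 512 * S ^ L ≤ 4 ^ L * L ^ L
  512*S^L≤4^L*L^L = begin
    512 * S ^ L          ≡⟨ cong (512 *_) (^-distribʳ-* 4 e L) ⟩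
    512 * (4 ^ L * e ^ L) ≡⟨ *-left-comm 512 (4 ^ L) (e ^ L) ⟩
    4 ^ L * (512 * e ^ L) ≤⟨ *-monoʳ-≤ (4 ^ L) (512*e^L≤L^L e 2≤e) ⟩
    4 ^ L * L ^ L        ∎
    where
    open ≤-Reasoning
    *-left-comm : ∀ a b c → a * (b * c) ≡ b * (a * c)
    *-left-comm = solve-∀

  -- Multiplying by 16^(k q) states |P| ≥ 2^(k L - 4k) without truncated subtraction.
  good-bound : ∀ {m k W P} → m ^ q ≤ k → k * L ≤ W + 4 * k → 2 ^ W ≤ P →
    m ^ q * S ^ (k * D * q) * 2 ^ (k * L) ≤ L ^ (k * D * q) * P ^ q
  good-bound {m} {k} {W} {P} m^q≤k kL≤W+4k 2^W≤P =
    *-cancelʳ-≤ _ _ (16 ^ (k * q)) {{m^n≢0 16 (k * q)}} (begin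
      m ^ q * S ^ (k * D * q) * 2 ^ (k * L) * 16 ^ (k * q)
        ≤⟨ *-monoˡ-≤ _ (*-monoˡ-≤ _ (*-monoˡ-≤ _ (≤-trans m^q≤k (n≤2^n k)))) ⟩
      2 ^ k * S ^ (k * D * q) * 2 ^ (k * L) * 16 ^ (k * q)
        ≡⟨ lhs-as-power ⟩
      (512 * S ^ L) ^ N
        ≤⟨ ^-monoˡ-≤ N 512*S^L≤4^L*L^L ⟩
      (4 ^ L * L ^ L) ^ N
        ≡⟨ rhs-as-power ⟩
      L ^ (k * D * q) * (2 ^ (k * L)) ^ q
        ≤⟨ *-monoʳ-≤ (L ^ (k * D * q)) (^-monoˡ-≤ q 2^kL≤P*16^k) ⟩
      L ^ (k * D * q) * (P * 16 ^ k) ^ q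
        ≡⟨ cong (L ^ (k * D * q) *_) (trans (^-distribʳ-* P (16 ^ k) q) (cong (P ^ q *_) (^-*-assoc 16 k q))) ⟩
      L ^ (k * D * q) * (P ^ q * 16 ^ (k * q))
        ≡⟨ sym (*-assoc (L ^ (k * D * q)) (P ^ q) _) ⟩
      L ^ (k * D * q) * P ^ q * 16 ^ (k * q) ∎)
    where
    open ≤-Reasoning
    N = k * r
    regroup : ∀ a b c d → a * b * c * d ≡ a * c * b * d
    regroup = solve-∀
    2*x*256≡512*x : ∀ x → 2 * x * 256 ≡ 512 * x
    2*x*256≡512*x = solve-∀
    k*q≡2*N : ∀ k r → k * (2 * r) ≡ 2 * (k * r)
    k*q≡2*N = solve-∀
    k+kL≡1*N : ∀ k L → k + k * L ≡ 1 * (k * suc L)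
    k+kL≡1*N = solve-∀
    kDq≡L*N : ∀ k D → k * D * (2 * suc (D + D)) ≡ (D + D) * (k * suc (D + D))
    kDq≡L*N = solve-∀
    2*[L*N]≡kL*q : ∀ k L → 2 * (L * (k * suc L)) ≡ k * L * (2 * suc L)
    2*[L*N]≡kL*q = solve-∀
    2^kL≤P*16^k : 2 ^ (k * L) ≤ P * 16 ^ k
    2^kL≤P*16^k = begin
      2 ^ (k * L)          ≤⟨ ^-monoʳ-≤ 2 kL≤W+4k ⟩
      2 ^ (W + 4 * k)      ≡⟨ ^-distribˡ-+-* 2 W (4 * k) ⟩
      2 ^ W * 2 ^ (4 * k)  ≡⟨ cong (2 ^ W *_) (sym (^-*-assoc 2 4 k)) ⟩
      2 ^ W * 16 ^ k       ≤⟨ *-monoˡ-≤ (16 ^ k) 2^W≤P ⟩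
      P * 16 ^ k           ∎
    lhs-as-power : 2 ^ k * S ^ (k * D * q) * 2 ^ (k * L) * 16 ^ (k * q) ≡ (512 * S ^ L) ^ N
    lhs-as-power = begin-equality
      2 ^ k * S ^ (k * D * q) * 2 ^ (k * L) * 16 ^ (k * q)
        ≡⟨ regroup (2 ^ k) (S ^ (k * D * q)) (2 ^ (k * L)) (16 ^ (k * q)) ⟩
      2 ^ k * 2 ^ (k * L) * S ^ (k * D * q) * 16 ^ (k * q)
        ≡⟨ cong₂ (λ a b → a * S ^ (k * D * q) * b) (sym (^-distribˡ-+-* 2 k (k * L))) (^-*-split 16 2 N (k*q≡2*N k r)) ⟩
      2 ^ (k + k * L) * S ^ (k * D * q) * 256 ^ N
        ≡⟨ cong₂ (λ a b → a * b * 256 ^ N) (^-*-split 2 1 N (k+kL≡1*N k L)) (^-*-split S L N (kDq≡L*N k D)) ⟩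
      2 ^ N * (S ^ L) ^ N * 256 ^ N
        ≡⟨ cong (_* 256 ^ N) (sym (^-distribʳ-* 2 (S ^ L) N)) ⟩
      (2 * S ^ L) ^ N * 256 ^ N
        ≡⟨ sym (^-distribʳ-* (2 * S ^ L) 256 N) ⟩
      (2 * S ^ L * 256) ^ N
        ≡⟨ cong (_^ N) (2*x*256≡512*x (S ^ L)) ⟩
      (512 * S ^ L) ^ N ∎
    rhs-as-power : (4 ^ L * L ^ L) ^ N ≡ L ^ (k * D * q) * (2 ^ (k * L)) ^ q
    rhs-as-power = begin-equality
      (4 ^ L * L ^ L) ^ N
        ≡⟨ ^-distribʳ-* (4 ^ L) (L ^ L) N ⟩
      (4 ^ L) ^ N * (L ^ L) ^ N
        ≡⟨ *-comm ((4 ^ L) ^ N) _ ⟩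
      (L ^ L) ^ N * (4 ^ L) ^ N
        ≡⟨ cong₂ _*_ (sym (^-*-split L L N (kDq≡L*N k D))) (^-*-assoc 4 L N) ⟩
      L ^ (k * D * q) * (2 ^ 2) ^ (L * N)
        ≡⟨ cong (L ^ (k * D * q) *_) (^-*-assoc 2 2 (L * N)) ⟩
      L ^ (k * D * q) * 2 ^ (2 * (L * N))
        ≡⟨ cong (L ^ (k * D * q) *_) (^-*-split 2 (k * L) q (2*[L*N]≡kL*q k L)) ⟩
      L ^ (k * D * q) * (2 ^ (k * L)) ^ q ∎

open import Data.Integer as ℤ using (ℤ; +_; -[1+_])
import Data.Integer.Properties as ℤP
open import Data.List.Membership.DecPropositional ℤ._≟_ using (_∈?_)

hits : List ℤ → ℤ → ℤ → ℕ
hits B x z = ∑ B λ y → ⟦ does (x ℤ.+ y ℤ.≟ z) ⟧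

reps : List ℤ → List ℤ → ℤ → ℕ
reps A B z = ∑ A λ x → hits B x z

1≤hits : ∀ {B x y z} → y ∈ B → x ℤ.+ y ≡ z → 1 ≤ hits B x z
1≤hits {x = x} {y} {z} y∈ eq =
  ≤-trans (≤-reflexive (sym (⟦does⟧≡1 (x ℤ.+ y ℤ.≟ z) eq))) (∈⇒≤∑ (λ y → ⟦ does (x ℤ.+ y ℤ.≟ z) ⟧) y∈)

1≤reps : ∀ {A B x y z} → x ∈ A → y ∈ B → x ℤ.+ y ≡ z → 1 ≤ reps A B z
1≤reps {B = B} {x} {z = z} x∈ y∈ eq = ≤-trans (1≤hits {x = x} y∈ eq) (∈⇒≤∑ (λ x → hits B x z) x∈)

reps-comm : ∀ A B z → reps A B z ≡ reps B A z
reps-comm A B z = trans (∑-swap A B _)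
  (∑-cong B (λ y → ∑-cong A (λ x → cong (λ s → ⟦ does (s ℤ.≟ z) ⟧) (ℤP.+-comm x y))))

reps-if : ∀ b A B z → reps (if b then A else B) (if b then B else A) z ≡ reps A B z
reps-if true  A B z = refl
reps-if false A B z = reps-comm B A z

sums-to : ∀ {n} → Vec ℤ n → Vec ℤ n × Vec ℤ n → ℕ
sums-to c ab = ⟦ does (VecP.≡-dec ℤ._≟_ (zipWith ℤ._+_ (proj₁ ab) (proj₂ ab)) c) ⟧

solutions : (n : ℕ) → (Fin n → List ℤ) → (Fin n → List ℤ) → Vec ℤ n → ℕ
solutions n L₁ L₂ c = ∑ (cartesianProduct (vecsFrom n L₁) (vecsFrom n L₂)) (sums-to c)

Pcard≡solutions : ∀ n c C₁ C₂ → Pcard n c C₁ C₂ ≡ solutions n (halfSel n C₁ C₂) (halfSel n C₂ C₁) c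
Pcard≡solutions n c C₁ C₂ =
  length-filter≡∑ (λ ab → VecP.≡-dec ℤ._≟_ (zipWith ℤ._+_ (proj₁ ab) (proj₂ ab)) c)
    (cartesianProduct (vecsFrom n (halfSel n C₁ C₂)) (vecsFrom n (halfSel n C₂ C₁)))

∑-vecsFrom-suc : ∀ n (L : Fin (suc n) → List ℤ) f →
  ∑ (vecsFrom (suc n) L) f ≡ ∑ (L Fin.zero) (λ x → ∑ (vecsFrom n (λ i → L (Fin.suc i))) (λ v → f (x Vec.∷ v)))
∑-vecsFrom-suc n L f =
  trans (∑-concatMap _ (L Fin.zero) f) (∑-cong (L Fin.zero) (λ x → ∑-map (x Vec.∷_) (vecsFrom n (λ i → L (Fin.suc i))) f))

solutions-∷ : ∀ n L₁ L₂ z c →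
  solutions (suc n) L₁ L₂ (z Vec.∷ c)
    ≡ reps (L₁ Fin.zero) (L₂ Fin.zero) z * solutions n (λ i → L₁ (Fin.suc i)) (λ i → L₂ (Fin.suc i)) c
solutions-∷ n L₁ L₂ z c = begin
  ∑ (cartesianProduct V₁′ V₂′) (sums-to (z Vec.∷ c))
    ≡⟨ ∑-cartesianProduct V₁′ V₂′ _ ⟩
  ∑ V₁′ (λ a → ∑ V₂′ (λ b → sums-to (z Vec.∷ c) (a , b)))
    ≡⟨ ∑-vecsFrom-suc n L₁ _ ⟩
  ∑ X (λ x → ∑ V₁ (λ v → ∑ V₂′ (λ b → sums-to (z Vec.∷ c) (x Vec.∷ v , b))))
    ≡⟨ ∑-cong X (λ x → ∑-cong V₁ (λ v → second-factor x v)) ⟩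
  ∑ X (λ x → ∑ V₁ (λ v → hits Y x z * ∑ V₂ (λ w → sums-to c (v , w))))
    ≡⟨ ∑-product X V₁ (λ x → hits Y x z) _ ⟩
  reps X Y z * ∑ V₁ (λ v → ∑ V₂ (λ w → sums-to c (v , w)))
    ≡⟨ cong (reps X Y z *_) (sym (∑-cartesianProduct V₁ V₂ (sums-to c))) ⟩
  reps X Y z * solutions n (λ i → L₁ (Fin.suc i)) (λ i → L₂ (Fin.suc i)) c ∎
  where
  open ≡-Reasoning
  X = L₁ Fin.zero
  Y = L₂ Fin.zero
  V₁ = vecsFrom n (λ i → L₁ (Fin.suc i))
  V₂ = vecsFrom n (λ i → L₂ (Fin.suc i))
  V₁′ = vecsFrom (suc n) L₁
  V₂′ = vecsFrom (suc n) L₂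
  second-factor : ∀ x v →
    ∑ V₂′ (λ b → sums-to (z Vec.∷ c) (x Vec.∷ v , b)) ≡ hits Y x z * ∑ V₂ (λ w → sums-to c (v , w))
  second-factor x v = begin
    ∑ V₂′ (λ b → sums-to (z Vec.∷ c) (x Vec.∷ v , b))
      ≡⟨ ∑-vecsFrom-suc n L₂ _ ⟩
    ∑ Y (λ y → ∑ V₂ (λ w → sums-to (z Vec.∷ c) (x Vec.∷ v , y Vec.∷ w)))
      ≡⟨ ∑-cong Y (λ y → ∑-cong V₂ (λ w → ⟦∧⟧ (does (x ℤ.+ y ℤ.≟ z)) _)) ⟩
    ∑ Y (λ y → ∑ V₂ (λ w → ⟦ does (x ℤ.+ y ℤ.≟ z) ⟧ * sums-to c (v , w)))
      ≡⟨ ∑-product Y V₂ _ _ ⟩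
    hits Y x z * ∑ V₂ (λ w → sums-to c (v , w)) ∎

2^∑≤solutions : ∀ n L₁ L₂ (c : Vec ℤ n) (w : ℤ → ℕ) →
  (∀ i → 2 ^ w (lookup c i) ≤ reps (L₁ i) (L₂ i) (lookup c i)) →
  2 ^ ∑ (toList c) w ≤ solutions n L₁ L₂ c
2^∑≤solutions zero    L₁ L₂ Vec.[]       w h = ≤-refl
2^∑≤solutions (suc n) L₁ L₂ (z Vec.∷ c) w h =
  subst₂ _≤_ (sym (^-distribˡ-+-* 2 (w z) _)) (sym (solutions-∷ n L₁ L₂ z c))
    (*-mono-≤ (h Fin.zero) (2^∑≤solutions n _ _ c w (λ i → h (Fin.suc i))))

∈-map++map⁻ : ∀ {f g : ℕ → ℤ} n {z} → z ∈ map f (upTo n) ++ map g (upTo n) →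
  (∃[ k ] k < n × z ≡ f k) ⊎ (∃[ k ] k < n × z ≡ g k)
∈-map++map⁻ {f} {g} n z∈ with ∈-++⁻ (map f (upTo n)) z∈
... | inj₁ z∈ˡ with k , k∈ , eq ← ∈-map⁻ f z∈ˡ = inj₁ (k , ∈-upTo⁻ k∈ , eq)
... | inj₂ z∈ʳ with k , k∈ , eq ← ∈-map⁻ g z∈ʳ = inj₂ (k , ∈-upTo⁻ k∈ , eq)

length-map++map : ∀ (f g : ℕ → ℤ) n → length (map f (upTo n) ++ map g (upTo n)) ≡ n + n
length-map++map f g n = begin
  length (map f (upTo n) ++ map g (upTo n))    ≡⟨ ListP.length-++ (map f (upTo n)) ⟩
  length (map f (upTo n)) + length (map g (upTo n)) ≡⟨ cong₂ _+_ (lengthMap f) (lengthMap g) ⟩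
  n + n                                        ∎
  where
  open ≡-Reasoning
  lengthMap : ∀ (h : ℕ → ℤ) → length (map h (upTo n)) ≡ n
  lengthMap h = trans (ListP.length-map h (upTo n)) (ListP.length-upTo n)

neg∈Cset : ∀ {d k} → k < d → -[1+ k ] ∈ Cset d
neg∈Cset k<d = ∈-++⁺ˡ (∈-map⁺ -[1+_] (∈-upTo⁺ k<d))

pos∈Cset : ∀ {d k} → k < d → + suc k ∈ Cset d
pos∈Cset {d} k<d = ∈-++⁺ʳ (map -[1+_] (upTo d)) (∈-map⁺ (λ k → + suc k) (∈-upTo⁺ k<d))

C₁ : List ℤ
C₁ = + 0 ∷ + 1 ∷ []

C₂ : ℕ → List ℤ
C₂ e = map (λ k → -[1+ suc k ]) (upTo e) ++ map (λ k → + suc k) (upTo e)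

neg∈C₂ : ∀ {e k} → k < e → -[1+ suc k ] ∈ C₂ e
neg∈C₂ k<e = ∈-++⁺ˡ (∈-map⁺ (λ k → -[1+ suc k ]) (∈-upTo⁺ k<e))

pos∈C₂ : ∀ {e k} → k < e → + suc k ∈ C₂ e
pos∈C₂ {e} k<e = ∈-++⁺ʳ (map (λ k → -[1+ suc k ]) (upTo e)) (∈-map⁺ (λ k → + suc k) (∈-upTo⁺ k<e))

unique-C₁ : Unique C₁
unique-C₁ = ((λ ()) ∷ []) ∷ [] ∷ []

unique-C₂ : ∀ e → Unique (C₂ e)
unique-C₂ e = Unique.++⁺ (Unique.map⁺ neg-injective (Unique.upTo⁺ e))
                         (Unique.map⁺ pos-injective (Unique.upTo⁺ e)) disjoint
  where
  neg-injective : ∀ {x y} → -[1+ suc x ] ≡ -[1+ suc y ] → x ≡ y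
  neg-injective refl = refl
  pos-injective : ∀ {x y} → + suc x ≡ + suc y → x ≡ y
  pos-injective refl = refl
  disjoint : ∀ {v} → ¬ (v ∈ map (λ k → -[1+ suc k ]) (upTo e) × v ∈ map (λ k → + suc k) (upTo e))
  disjoint (v∈ˡ , v∈ʳ) with ∈-map⁻ _ v∈ˡ | ∈-map⁻ _ v∈ʳ
  ... | _ , _ , refl | _ , _ , ()

size-C₁C₂ : ∀ e → length C₁ * length (C₂ e) ≡ 4 * e
size-C₁C₂ e = trans (cong (2 *_) (length-map++map _ _ e)) (double-double e)
  where
  double-double : ∀ e → 2 * (e + e) ≡ 4 * e
  double-double = solve-∀

size-Cset : ∀ d → length (Cset d) ≡ d + d
size-Cset = length-map++map -[1+_] (λ k → + suc k)

sumset : ∀ {e} → 0 < e → SumsetEq C₁ (C₂ e) (Cset (suc e))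
sumset {e} 0<e z = mk⇔ split join
  where
  split : z ∈ Cset (suc e) → ∃[ a ] ∃[ b ] (a ∈ C₁ × b ∈ C₂ e × z ≡ a ℤ.+ b)
  split z∈ with ∈-map++map⁻ (suc e) z∈
  ... | inj₁ (zero  , _         , refl) = + 1 , -[1+ 1 ] , there (here refl) , neg∈C₂ 0<e , refl
  ... | inj₁ (suc j , s≤s j<e , refl) = + 0 , -[1+ suc j ] , here refl , neg∈C₂ j<e , refl
  ... | inj₂ (zero  , _         , refl) = + 0 , + 1 , here refl , pos∈C₂ 0<e , refl
  ... | inj₂ (suc j , s≤s j<e , refl) = + 1 , + suc j , there (here refl) , pos∈C₂ j<e , refl
  join : ∃[ a ] ∃[ b ] (a ∈ C₁ × b ∈ C₂ e × z ≡ a ℤ.+ b) → z ∈ Cset (suc e)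
  join (a , b , a∈ , b∈ , refl) with a∈ | ∈-map++map⁻ e b∈
  ... | here refl         | inj₁ (k , k<e , refl) = neg∈Cset (s≤s k<e)
  ... | there (here refl) | inj₁ (k , k<e , refl) = neg∈Cset (m<n⇒m<1+n k<e)
  ... | here refl         | inj₂ (k , k<e , refl) = pos∈Cset (m<n⇒m<1+n k<e)
  ... | there (here refl) | inj₂ (k , k<e , refl) = pos∈Cset (s≤s k<e)

exceptional : ℕ → List ℤ
exceptional e = -[1+ e ] ∷ -[1+ 0 ] ∷ + 1 ∷ + suc e ∷ []

weight : ℕ → ℤ → ℕ
weight e z with z ∈? exceptional e
... | yes _ = 0
... | no  _ = 1

unexceptional⇒doubly-represented : ∀ {e z} → z ∈ Cset (suc e) → z ∉ exceptional e →
  z ∈ C₂ e × ℤ.pred z ∈ C₂ e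
unexceptional⇒doubly-represented {e} z∈ z∉ with ∈-map++map⁻ (suc e) z∈
... | inj₁ (zero  , _       , refl) = ⊥-elim (z∉ (there (here refl)))
... | inj₂ (zero  , _       , refl) = ⊥-elim (z∉ (there (there (here refl))))
... | inj₁ (suc j , s≤s j<e , refl) with suc j <? e
...   | yes 1+j<e = neg∈C₂ j<e , neg∈C₂ 1+j<e
...   | no  1+j≮e = ⊥-elim (z∉ (here (cong -[1+_] (≤-antisym j<e (≮⇒≥ 1+j≮e)))))
unexceptional⇒doubly-represented {e} z∈ z∉ | inj₂ (suc j , s≤s j<e , refl) with suc j <? e
...   | yes 1+j<e = pos∈C₂ 1+j<e , pos∈C₂ j<e
...   | no  1+j≮e = ⊥-elim (z∉ (there (there (there (here (cong (λ k → + suc k) (≤-antisym j<e (≮⇒≥ 1+j≮e))))))))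

2^weight≤reps : ∀ {e z} → 0 < e → z ∈ Cset (suc e) → 2 ^ weight e z ≤ reps C₁ (C₂ e) z
2^weight≤reps {e} {z} 0<e z∈ with z ∈? exceptional e
... | yes _
  with a , b , a∈ , b∈ , eq ← Equivalence.to (sumset 0<e z) z∈ = 1≤reps a∈ b∈ (sym eq)
... | no z∉
  with z∈C₂ , z-1∈C₂ ← unexceptional⇒doubly-represented z∈ z∉ =
  +-mono-≤ (1≤hits {x = + 0} z∈C₂ (ℤP.+-identityˡ z)) (+-mono-≤ (1≤hits {x = + 1} z-1∈C₂ (ℤP.suc-pred z)) z≤n)

1≤weight+exceptional : ∀ e z → 1 ≤ weight e z + ∑ (exceptional e) (λ x → ⟦ does (z ℤ.≟ x) ⟧)
1≤weight+exceptional e z with z ∈? exceptional e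
... | yes z∈ = ≤-trans (≤-reflexive (sym (⟦does⟧≡1 (z ℤ.≟ z) refl)))
                       (∈⇒≤∑ (λ x → ⟦ does (z ℤ.≟ x) ⟧) z∈)
... | no _   = s≤s z≤n

exceptional⊆Cset : ∀ {e x} → x ∈ exceptional e → x ∈ Cset (suc e)
exceptional⊆Cset {e} (here refl)                         = neg∈Cset (n<1+n e)
exceptional⊆Cset (there (here refl))                     = neg∈Cset (s≤s z≤n)
exceptional⊆Cset (there (there (here refl)))             = pos∈Cset (s≤s z≤n)
exceptional⊆Cset {e} (there (there (there (here refl)))) = pos∈Cset (n<1+n e)

occ≡∑ : ∀ {n} x (c : Vec ℤ n) → occ x c ≡ ∑ (toList c) (λ y → ⟦ does (y ℤ.≟ x) ⟧)
occ≡∑ x c = length-filter≡∑ (ℤ._≟ x) (toList c)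

occ-uniform : ∀ {C n c x y} → PerfectlyBalanced C n c → x ∈ C → y ∈ C → occ x c ≡ occ y c
occ-uniform {[]}    _         ()  _
occ-uniform {_ ∷ _} (_ , bal) x∈ y∈ = *-cancelʳ-≡ _ _ _ (trans (bal _ x∈) (sym (bal _ y∈)))

n≤∑weight+4occ : ∀ {e n c} → PerfectlyBalanced (Cset (suc e)) n c →
  n ≤ ∑ (toList c) (weight e) + 4 * occ (+ 1) c
n≤∑weight+4occ {e} {n} {c} balanced = begin
  n                                                 ≡⟨ length-as-∑ ⟩
  ∑ (toList c) (λ _ → 1)                            ≤⟨ ∑-toList-mono c (λ i → 1≤weight+exceptional e (lookup c i)) ⟩
  ∑ (toList c) (λ z → weight e z + exc z)           ≡⟨ ∑-+ (toList c) (weight e) exc ⟩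
  ∑ (toList c) (weight e) + ∑ (toList c) exc        ≡⟨ cong (_+_ (∑ (toList c) (weight e))) exceptional-occurrences ⟩
  ∑ (toList c) (weight e) + 4 * occ (+ 1) c         ∎
  where
  open ≤-Reasoning
  exc : ℤ → ℕ
  exc z = ∑ (exceptional e) (λ x → ⟦ does (z ℤ.≟ x) ⟧)
  length-as-∑ : n ≡ ∑ (toList c) (λ _ → 1)
  length-as-∑ = sym (trans (∑-const-on (toList c) (λ _ _ → refl))
                           (trans (*-identityʳ _) (VecP.length-toList c)))
  exceptional-occurrences : ∑ (toList c) exc ≡ 4 * occ (+ 1) c
  exceptional-occurrences = begin-equality
    ∑ (toList c) exc                                  ≡⟨ ∑-swap (toList c) (exceptional e) (λ z x → ⟦ does (z ℤ.≟ x) ⟧) ⟩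
    ∑ (exceptional e) (λ x → ∑ (toList c) (λ z → ⟦ does (z ℤ.≟ x) ⟧))
      ≡⟨ ∑-cong (exceptional e) (λ x → sym (occ≡∑ x c)) ⟩
    ∑ (exceptional e) (λ x → occ x c)
      ≡⟨ ∑-const-on (exceptional e) (λ x x∈ → occ-uniform {c = c} balanced (exceptional⊆Cset x∈) (pos∈Cset (s≤s z≤n))) ⟩
    4 * occ (+ 1) c                                   ∎

2^∑weight≤Pcard : ∀ {e n c} → 0 < e → PerfectlyBalanced (Cset (suc e)) n c →
  2 ^ ∑ (toList c) (weight e) ≤ Pcard n c C₁ (C₂ e)
2^∑weight≤Pcard {e} {n} {c} 0<e (c∈C , _) =
  subst (2 ^ ∑ (toList c) (weight e) ≤_) (sym (Pcard≡solutions n c C₁ (C₂ e)))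
    (2^∑≤solutions n _ _ c (weight e) (λ i →
      subst (2 ^ weight e (lookup c i) ≤_) (sym (reps-if (toℕ i <ᵇ n / 2) C₁ (C₂ e) (lookup c i)))
        (2^weight≤reps 0<e (c∈C i))))

module _ (e : ℕ) (2≤e : 2 ≤ e) where
  open Exponents e 2≤e

  0<e : 0 < e
  0<e = ≤-trans (s≤s z≤n) 2≤e

  balanced-bound : ∀ {m n c} → m ^ q * L ≤ n → PerfectlyBalanced (Cset D) n c →
    m ^ q * (length C₁ * length (C₂ e)) ^ (n / 2 * q) * 2 ^ (1 * n)
      ≤ length (Cset D) ^ (n / 2 * q) * Pcard n c C₁ (C₂ e) ^ q
  balanced-bound {m} {n} {c} m^qL≤n balanced = begin
    m ^ q * (length C₁ * length (C₂ e)) ^ (n / 2 * q) * 2 ^ (1 * n)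
      ≡⟨ cong₂ _*_ (cong₂ (λ s h → m ^ q * s ^ (h * q)) (size-C₁C₂ e) n/2≡kD)
                   (cong (2 ^_) (trans (*-identityˡ n) n≡kL)) ⟩
    m ^ q * S ^ (k * D * q) * 2 ^ (k * L)
      ≤⟨ good-bound {m} {W = W} m^q≤k (subst (_≤ W + 4 * k) n≡kL (n≤∑weight+4occ {c = c} balanced))
                    (2^∑weight≤Pcard {c = c} 0<e balanced) ⟩
    L ^ (k * D * q) * P ^ q
      ≡⟨ sym (cong₂ (λ l h → l ^ (h * q) * P ^ q) (size-Cset D) n/2≡kD) ⟩
    length (Cset D) ^ (n / 2 * q) * P ^ q ∎
    where
    open ≤-Reasoning
    k = occ (+ 1) c
    W = ∑ (toList c) (weight e)
    P = Pcard n c C₁ (C₂ e)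
    n≡kL : n ≡ k * L
    n≡kL = sym (trans (cong (k *_) (sym (size-Cset D))) (proj₂ balanced (+ 1) (pos∈Cset (s≤s z≤n))))
    m^q≤k : m ^ q ≤ k
    m^q≤k = *-cancelʳ-≤ _ _ L (subst (m ^ q * L ≤_) n≡kL m^qL≤n)
    n/2≡kD : n / 2 ≡ k * D
    n/2≡kD = trans (cong (_/ 2) (trans n≡kL (k*[D+D]≡k*D*2 k D))) (m*n/n≡m (k * D) 2)
      where
      k*[D+D]≡k*D*2 : ∀ k D → k * (D + D) ≡ k * D * 2
      k*[D+D]≡k*D*2 = solve-∀

lemma6p4 : ∀ (d : ℕ) → 2 < d → HasGoodFactors (Cset d)
lemma6p4 (suc e) (s≤s 2≤e) =
  C₁ , C₂ e , unique-C₁ , unique-C₂ e , sumset (0<e e 2≤e) ,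
  1 , q , ≤-refl , s≤s z≤n ,
  λ m _ → m ^ q * L , λ n m^qL≤n _ c balanced → balanced-bound e 2≤e {m} {n} {c} m^qL≤n balanced
  where open Exponents e 2≤e
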